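{- Let $\mathcal{R}$ be a good base of size $m$ (over $n$-bit strings) and let $d=\frac{n}{4\log m}-1$. Then, for $r=(r_1,\dots,r_m)$ drawn uniformly from $\mathcal{R}$, $$\Pr_{r\leftarrow\mathcal{R}}\Big[\forall T\subseteq[m] \text{ with } |T|\le d:\ \bigoplus_{i\in T} r_i\ne 1^n\Big]\ge\frac23,$$ where $\bigoplus$ denotes bitwise XOR.
   Context: For $\tau\in\{0,1\}^n$ let $\mathcal{R}^\tau=\{v\in\{0,1\}^n: v_k=0 \text{ for every } k \text{ with } \tau_k=0\}$. Let $\mathbf{1}_j\in\{0,1\}^n$ be the string with a 1 in position $j$ and 0 elsewhere. A good base of size $m=n+m'$ is a set of the form $\mathcal{R}=\{\mathbf{1}_1\}\times\cdots\times\{\mathbf{1}_n\}\times\mathcal{R}^{\tau^{(1)}}\times\cdots\times\mathcal{R}^{\tau^{(m')}}$ for some templates $\tau^{(1)},\dots,\tau^{(m')}\in\{0,1\}^n$; an element is an $m$-tuple $r=(r_1,\dots,r_m)$ of $n$-bit strings, and sampling $r$ uniformly from $\mathcal{R}$ means each $r_{n+j}$ is uniform on $\mathcal{R}^{\tau^{(j)}}$, independently. $[m]=\{1,\dots,m\}$; logarithms are base 2. -}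

module Defs where

open import Data.Bool using (Bool; true; false; not; _∧_; _∨_; _xor_; if_then_else_)
open import Data.Nat using (ℕ; zero; suc; _+_; _*_; _^_; _≤ᵇ_)
open import Data.Fin using (Fin)
import Data.Fin as F
open import Data.Vec using (Vec; []; _∷_; replicate; zipWith; tabulate; _++_)
open import Data.Vec.Properties using (≡-dec)
import Data.Bool as B
open import Data.List using (List; [_]; map; concatMap; filter; length)
import Data.List as L
open import Data.Fin.Subset using (Subset; ∣_∣)
open import Relation.Nullary using (does)

Bits : ℕ → Set
Bits n = Vec Bool n

unitVec : {n : ℕ} → Fin n → Bits n
unitVec j = tabulate (λ k → does (k F.≟ j))

units : (n : ℕ) → Vec (Bits n) n
units n = tabulate unitVec

-- enumeration (without repetition) of R^τ = { v : v_k = 0 whenever τ_k = 0 }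
below : {n : ℕ} → Bits n → List (Bits n)
below [] = [ [] ]
below (false ∷ τ) = map (false ∷_) (below τ)
below (true ∷ τ) = map (false ∷_) (below τ) L.++ map (true ∷_) (below τ)

products : {n m' : ℕ} → Vec (Bits n) m' → List (Vec (Bits n) m')
products [] = [ [] ]
products (τ ∷ τs) = concatMap (λ v → map (v ∷_) (products τs)) (below τ)

-- enumeration (without repetition) of the good base R with templates τs
goodBase : {n m' : ℕ} → Vec (Bits n) m' → List (Vec (Bits n) (n + m'))
goodBase {n} τs = map (λ rest → units n ++ rest) (products τs)

allSubsets : (m : ℕ) → List (Subset m)
allSubsets zero = [ [] ]
allSubsets (suc m) = map (false ∷_) (allSubsets m) L.++ map (true ∷_) (allSubsets m)

xorSum : {n m : ℕ} → Subset m → Vec (Bits n) m → Bits n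
xorSum {n} [] [] = replicate n false
xorSum (b ∷ T) (r ∷ rs) = if b then zipWith _xor_ r (xorSum T rs) else xorSum T rs

isOnes : {n : ℕ} → Bits n → Bool
isOnes {n} v = does (≡-dec B._≟_ v (replicate n true))

-- |T| ≤ d  where d = n/(4 log₂ m) - 1  (for m ≥ 2), i.e.
-- 4(|T|+1) log₂ m ≤ n, i.e. m^(4(|T|+1)) ≤ 2^n
smallEnough : {m : ℕ} → (n : ℕ) → Subset m → Bool
smallEnough {m} n T = (m ^ (4 * suc ∣ T ∣)) ≤ᵇ (2 ^ n)

allB : {A : Set} → (A → Bool) → List A → Bool
allB p L.[] = true
allB p (x L.∷ xs) = p x ∧ allB p xs

event : {n m : ℕ} → Vec (Bits n) m → Bool
event {n} {m} r = allB (λ T → not (smallEnough n T) ∨ not (isOnes (xorSum T r))) (allSubsets m)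

countEvent : {n m' : ℕ} → Vec (Bits n) m' → ℕ
countEvent τs = length (filter (λ r → event r B.≟ true) (goodBase τs))

{-# OPTIONS --safe #-}
-- By the union bound it suffices that the probabilities Pr[⊕_{i∈T} r_i = 1ⁿ], summed over the
-- small T, are at most 1/3.  Write T ⊆ [n + m'] as T₁ ++ T₂, with T₁ on the unit vectors and T₂ on
-- the templates; then ⊕_T r = 1ⁿ says that the random template vectors selected by T₂ sum to ∁ T₁.
-- A sum of independent uniform vectors of the subspaces R^τ is uniform on R^(⋃ τ), so this has
-- probability at most 2^-(n - |T₁|) ≤ 2^(|T| - n).  Finally the weights 2^|T| of the T with
-- m^(4(|T|+1)) ≤ 2ⁿ add up to at most 2ⁿ/3: each further element of T costs a factor m⁴ in the
-- threshold but gains only a factor 2 in the weight.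

module Submission where

open import Defs
open import Data.Bool using (Bool; true; false; not; _∧_; _∨_; _xor_; T)
import Data.Bool as Bool
open import Data.Nat using (ℕ; zero; suc; _+_; _*_; _^_; _≤_; _≤ᵇ_; z≤n; s≤s; NonZero; >-nonZero)
open import Data.Nat.Properties
open import Data.Nat.Tactic.RingSolver using (solve-∀)
open import Algebra.Properties.CommutativeSemigroup +-commutativeSemigroup
  using () renaming (interchange to +-interchange)
open import Algebra.Properties.CommutativeSemigroup *-commutativeSemigroup
  using () renaming (x∙yz≈y∙xz to x*[y*z]≡y*[x*z])
open import Data.List using (List; []; _∷_; map; concatMap; filter; length)
import Data.List as List
open import Data.List.Properties using (length-map)
open import Data.Vec using (Vec; []; _∷_; tabulate; _++_; splitAt)
open import Data.Fin using (Fin)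
import Data.Fin as Fin
open import Data.Fin.Subset using (Subset; ∣_∣; ⊥; ⊤; ∁; _∪_; _∩_)
open import Data.Fin.Subset.Properties using (∣⊥∣≡0; ∣∁p∣≡n∸∣p∣; ∣p∣≤n)
open import Data.Product using (_,_)
open import Data.Unit using (tt)
open import Function using (_∘_)
open import Relation.Nullary using (does)
open import Relation.Binary.PropositionalEquality

private variable
  A B : Set
  n m' : ℕ

∑ : List A → (A → ℕ) → ℕ
∑ []       f = 0
∑ (x ∷ xs) f = f x + ∑ xs f

infix 5 ∑
syntax ∑ xs (λ x → e) = ∑[ x ∈ xs ] e

∑-cong : {f g : A → ℕ} (xs : List A) → (∀ x → f x ≡ g x) → ∑ xs f ≡ ∑ xs g
∑-cong []       f≗g = refl
∑-cong (x ∷ xs) f≗g = cong₂ _+_ (f≗g x) (∑-cong xs f≗g)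

∑-mono-≤ : {f g : A → ℕ} (xs : List A) → (∀ x → f x ≤ g x) → ∑ xs f ≤ ∑ xs g
∑-mono-≤ []       f≤g = z≤n
∑-mono-≤ (x ∷ xs) f≤g = +-mono-≤ (f≤g x) (∑-mono-≤ xs f≤g)

∑-++ : (f : A → ℕ) (xs ys : List A) → ∑ (xs List.++ ys) f ≡ ∑ xs f + ∑ ys f
∑-++ f []       ys = refl
∑-++ f (x ∷ xs) ys = trans (cong (f x +_) (∑-++ f xs ys)) (sym (+-assoc (f x) _ _))

∑-map : (f : B → ℕ) (g : A → B) (xs : List A) → ∑ (map g xs) f ≡ ∑ xs (f ∘ g)
∑-map f g []       = refl
∑-map f g (x ∷ xs) = cong (f (g x) +_) (∑-map f g xs)

∑-map++map : (f : B → ℕ) (g h : A → B) (xs : List A) →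
  ∑ (map g xs List.++ map h xs) f ≡ ∑ xs (f ∘ g) + ∑ xs (f ∘ h)
∑-map++map f g h xs = trans (∑-++ f (map g xs) (map h xs)) (cong₂ _+_ (∑-map f g xs) (∑-map f h xs))

∑-concatMap : (f : B → ℕ) (g : A → List B) (xs : List A) →
  ∑ (concatMap g xs) f ≡ ∑[ x ∈ xs ] ∑ (g x) f
∑-concatMap f g []       = refl
∑-concatMap f g (x ∷ xs) = trans (∑-++ f (g x) (concatMap g xs)) (cong (∑ (g x) f +_) (∑-concatMap f g xs))

∑-+ : (f g : A → ℕ) (xs : List A) → ∑[ x ∈ xs ] (f x + g x) ≡ ∑ xs f + ∑ xs g
∑-+ f g []       = refl
∑-+ f g (x ∷ xs) = trans (cong (f x + g x +_) (∑-+ f g xs)) (+-interchange (f x) (g x) (∑ xs f) (∑ xs g))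

∑-*ˡ : (c : ℕ) (f : A → ℕ) (xs : List A) → ∑[ x ∈ xs ] c * f x ≡ c * ∑ xs f
∑-*ˡ c f []       = sym (*-zeroʳ c)
∑-*ˡ c f (x ∷ xs) = trans (cong (c * f x +_) (∑-*ˡ c f xs)) (sym (*-distribˡ-+ c (f x) (∑ xs f)))

∑-const : (c : ℕ) (xs : List A) → ∑[ _ ∈ xs ] c ≡ length xs * c
∑-const c []       = refl
∑-const c (x ∷ xs) = cong (c +_) (∑-const c xs)

∑-zero : (xs : List A) → ∑[ _ ∈ xs ] 0 ≡ 0
∑-zero xs = trans (∑-const 0 xs) (*-zeroʳ (length xs))

length≡∑1 : (xs : List A) → length xs ≡ ∑[ _ ∈ xs ] 1
length≡∑1 xs = sym (trans (∑-const 1 xs) (*-identityʳ (length xs)))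

∑-comm : (f : A → B → ℕ) (xs : List A) (ys : List B) →
  ∑[ x ∈ xs ] ∑[ y ∈ ys ] f x y ≡ ∑[ y ∈ ys ] ∑[ x ∈ xs ] f x y
∑-comm f []       ys = sym (∑-zero ys)
∑-comm f (x ∷ xs) ys = trans (cong (∑ ys (f x) +_) (∑-comm f xs ys)) (sym (∑-+ (f x) _ ys))

∑-*-≤ : {f g : A → ℕ} {N L : ℕ} (xs : List A) →
  (∀ x → f x * N ≤ L * g x) → ∑ xs f * N ≤ L * ∑ xs g
∑-*-≤ {L = L} [] f≤g = ≤-reflexive (sym (*-zeroʳ L))
∑-*-≤ {f = f} {g} {N} {L} (x ∷ xs) f≤g = begin
  (f x + ∑ xs f) * N     ≡⟨ *-distribʳ-+ N (f x) (∑ xs f) ⟩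
  f x * N + ∑ xs f * N   ≤⟨ +-mono-≤ (f≤g x) (∑-*-≤ {g = g} {L = L} xs f≤g) ⟩
  L * g x + L * ∑ xs g   ≡⟨ sym (*-distribˡ-+ L (g x) (∑ xs g)) ⟩
  L * (g x + ∑ xs g)     ∎
  where open ≤-Reasoning

𝟙[_] : Bool → ℕ
𝟙[ true  ] = 1
𝟙[ false ] = 0

count : (A → Bool) → List A → ℕ
count p xs = ∑[ x ∈ xs ] 𝟙[ p x ]

length-filter≡count : (p : A → Bool) (xs : List A) →
  length (filter (λ x → p x Bool.≟ true) xs) ≡ count p xs
length-filter≡count p []       = refl
length-filter≡count p (x ∷ xs) with p x
... | true  = cong suc (length-filter≡count p xs)
... | false = length-filter≡count p xs

-- Bit vectors as subsets

infixl 6 _⊕_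
infix 4 _≡ᵇ_ _⊆ᵇ_

_⊕_ : Bits n → Bits n → Bits n
_⊕_ = Data.Vec.zipWith _xor_

_≡ᵇ_ : Bits n → Bits n → Bool
[]      ≡ᵇ []      = true
(x ∷ v) ≡ᵇ (y ∷ w) = does (x Bool.≟ y) ∧ (v ≡ᵇ w)

_⊆ᵇ_ : Bits n → Bits n → Bool
[]      ⊆ᵇ []      = true
(x ∷ v) ⊆ᵇ (y ∷ w) = (not x ∨ y) ∧ (v ⊆ᵇ w)

⊥-⊕ : (v : Bits n) → ⊥ ⊕ v ≡ v
⊥-⊕ []      = refl
⊥-⊕ (x ∷ v) = cong (x ∷_) (⊥-⊕ v)

⊤-⊕ : (v : Bits n) → ⊤ ⊕ v ≡ ∁ v
⊤-⊕ []      = refl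
⊤-⊕ (x ∷ v) = cong (not x ∷_) (⊤-⊕ v)

⊕-assoc : (u v w : Bits n) → u ⊕ (v ⊕ w) ≡ u ⊕ v ⊕ w
⊕-assoc []      []      []      = refl
⊕-assoc (x ∷ u) (y ∷ v) (z ∷ w) = cong₂ _∷_ (xor-assoc x y z) (⊕-assoc u v w)
  where
  xor-assoc : ∀ x y z → x xor (y xor z) ≡ (x xor y) xor z
  xor-assoc false y z = refl
  xor-assoc true false z = refl
  xor-assoc true true false = refl
  xor-assoc true true true = refl

⊕-≡ᵇ : (v x w : Bits n) → (v ⊕ x ≡ᵇ w) ≡ (x ≡ᵇ w ⊕ v)
⊕-≡ᵇ []      []      []      = refl
⊕-≡ᵇ (a ∷ v) (b ∷ x) (c ∷ w) = cong₂ _∧_ (xor-≟ a b c) (⊕-≡ᵇ v x w)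
  where
  xor-≟ : ∀ a b c → does ((a xor b) Bool.≟ c) ≡ does (b Bool.≟ (c xor a))
  xor-≟ false false false = refl
  xor-≟ false false true  = refl
  xor-≟ false true  false = refl
  xor-≟ false true  true  = refl
  xor-≟ true  false false = refl
  xor-≟ true  false true  = refl
  xor-≟ true  true  false = refl
  xor-≟ true  true  true  = refl

⊥-≡ᵇ : (w : Bits n) → (⊥ ≡ᵇ w) ≡ (w ⊆ᵇ ⊥)
⊥-≡ᵇ []         = refl
⊥-≡ᵇ (false ∷ w) = ⊥-≡ᵇ w
⊥-≡ᵇ (true  ∷ w) = refl

isOnes≡≡ᵇ⊤ : (v : Bits n) → isOnes v ≡ (v ≡ᵇ ⊤)
isOnes≡≡ᵇ⊤ []      = refl
isOnes≡≡ᵇ⊤ (x ∷ v) = cong (does (x Bool.≟ true) ∧_) (isOnes≡≡ᵇ⊤ v)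

⊆ᵇ⇒∣∣≤ : (v w : Bits n) → T (v ⊆ᵇ w) → ∣ v ∣ ≤ ∣ w ∣
⊆ᵇ⇒∣∣≤ []          []          _   = z≤n
⊆ᵇ⇒∣∣≤ (false ∷ v) (false ∷ w) v⊆w = ⊆ᵇ⇒∣∣≤ v w v⊆w
⊆ᵇ⇒∣∣≤ (false ∷ v) (true  ∷ w) v⊆w = m≤n⇒m≤1+n (⊆ᵇ⇒∣∣≤ v w v⊆w)
⊆ᵇ⇒∣∣≤ (true  ∷ v) (true  ∷ w) v⊆w = s≤s (⊆ᵇ⇒∣∣≤ v w v⊆w)

∣p∩q∣+∣p∪q∣ : (p q : Subset n) → ∣ p ∩ q ∣ + ∣ p ∪ q ∣ ≡ ∣ p ∣ + ∣ q ∣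
∣p∩q∣+∣p∪q∣ []          []          = refl
∣p∩q∣+∣p∪q∣ (false ∷ p) (false ∷ q) = ∣p∩q∣+∣p∪q∣ p q
∣p∩q∣+∣p∪q∣ (false ∷ p) (true  ∷ q) =
  trans (+-suc _ _) (trans (cong suc (∣p∩q∣+∣p∪q∣ p q)) (sym (+-suc _ _)))
∣p∩q∣+∣p∪q∣ (true  ∷ p) (false ∷ q) = trans (+-suc _ _) (cong suc (∣p∩q∣+∣p∪q∣ p q))
∣p∩q∣+∣p∪q∣ (true  ∷ p) (true  ∷ q) =
  cong suc (trans (+-suc _ _) (trans (cong suc (∣p∩q∣+∣p∪q∣ p q)) (sym (+-suc _ _))))

2^∣p∩q∣*2^∣p∪q∣ : (p q : Subset n) → 2 ^ ∣ p ∩ q ∣ * 2 ^ ∣ p ∪ q ∣ ≡ 2 ^ ∣ p ∣ * 2 ^ ∣ q ∣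
2^∣p∩q∣*2^∣p∪q∣ p q = begin
  2 ^ ∣ p ∩ q ∣ * 2 ^ ∣ p ∪ q ∣  ≡⟨ sym (^-distribˡ-+-* 2 ∣ p ∩ q ∣ ∣ p ∪ q ∣) ⟩
  2 ^ (∣ p ∩ q ∣ + ∣ p ∪ q ∣)    ≡⟨ cong (2 ^_) (∣p∩q∣+∣p∪q∣ p q) ⟩
  2 ^ (∣ p ∣ + ∣ q ∣)            ≡⟨ ^-distribˡ-+-* 2 ∣ p ∣ ∣ q ∣ ⟩
  2 ^ ∣ p ∣ * 2 ^ ∣ q ∣          ∎
  where open ≡-Reasoning

∣∁p∣+∣p∣ : (p : Subset n) → ∣ ∁ p ∣ + ∣ p ∣ ≡ n
∣∁p∣+∣p∣ p = trans (cong (_+ ∣ p ∣) (∣∁p∣≡n∸∣p∣ p)) (m∸n+n≡m (∣p∣≤n p))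

∣p∣≤∣p++q∣ : {k l : ℕ} (p : Subset k) (q : Subset l) → ∣ p ∣ ≤ ∣ p ++ q ∣
∣p∣≤∣p++q∣ []          q = z≤n
∣p∣≤∣p++q∣ (false ∷ p) q = ∣p∣≤∣p++q∣ p q
∣p∣≤∣p++q∣ (true  ∷ p) q = s≤s (∣p∣≤∣p++q∣ p q)

-- Counting in the good base

xorSum-++ : {k l : ℕ} (p : Subset k) (q : Subset l) (us : Vec (Bits n) k) (vs : Vec (Bits n) l) →
  xorSum (p ++ q) (us ++ vs) ≡ xorSum p us ⊕ xorSum q vs
xorSum-++ []          q []       vs = sym (⊥-⊕ (xorSum q vs))
xorSum-++ (false ∷ p) q (u ∷ us) vs = xorSum-++ p q us vs
xorSum-++ (true  ∷ p) q (u ∷ us) vs = trans (cong (u ⊕_) (xorSum-++ p q us vs)) (⊕-assoc u _ _)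

xorSum-false∷ : {k : ℕ} (p : Subset k) (f : Fin k → Bits n) →
  xorSum p (tabulate (λ j → false ∷ f j)) ≡ false ∷ xorSum p (tabulate f)
xorSum-false∷ []          f = refl
xorSum-false∷ (false ∷ p) f = xorSum-false∷ p (f ∘ Fin.suc)
xorSum-false∷ (true  ∷ p) f = cong ((false ∷ f Fin.zero) ⊕_) (xorSum-false∷ p (f ∘ Fin.suc))

xorSum-units : (p : Subset n) → xorSum p (units n) ≡ p
xorSum-units []          = refl
xorSum-units (false ∷ p) = trans (xorSum-false∷ p unitVec) (cong (false ∷_) (xorSum-units p))
xorSum-units {suc n} (true ∷ p) = begin
  unitVec Fin.zero ⊕ xorSum p (tabulate (unitVec ∘ Fin.suc))
    ≡⟨ cong (unitVec Fin.zero ⊕_) (trans (xorSum-false∷ p unitVec) (cong (false ∷_) (xorSum-units p))) ⟩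
  true ∷ (tabulate (λ k → does (Fin.suc k Fin.≟ Fin.zero)) ⊕ p)
    ≡⟨ cong (λ z → true ∷ (z ⊕ p)) (suc≟zero n) ⟩
  true ∷ (⊥ ⊕ p)
    ≡⟨ cong (true ∷_) (⊥-⊕ p) ⟩
  true ∷ p ∎
  where
  open ≡-Reasoning
  suc≟zero : (n : ℕ) → tabulate {n = n} (λ k → does (Fin.suc k Fin.≟ Fin.zero)) ≡ ⊥
  suc≟zero zero    = refl
  suc≟zero (suc n) = cong (false ∷_) (suc≟zero n)

isOnes-xorSum-units++ : {l : ℕ} (p : Subset n) (q : Subset l) (vs : Vec (Bits n) l) →
  isOnes (xorSum (p ++ q) (units n ++ vs)) ≡ (xorSum q vs ≡ᵇ ∁ p)
isOnes-xorSum-units++ {n} p q vs = begin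
  isOnes (xorSum (p ++ q) (units n ++ vs))        ≡⟨ isOnes≡≡ᵇ⊤ (xorSum (p ++ q) (units n ++ vs)) ⟩
  (xorSum (p ++ q) (units n ++ vs) ≡ᵇ ⊤)          ≡⟨ cong (_≡ᵇ ⊤) (xorSum-++ p q (units n) vs) ⟩
  (xorSum p (units n) ⊕ xorSum q vs ≡ᵇ ⊤)         ≡⟨ cong (λ z → z ⊕ xorSum q vs ≡ᵇ ⊤) (xorSum-units p) ⟩
  (p ⊕ xorSum q vs ≡ᵇ ⊤)                          ≡⟨ ⊕-≡ᵇ p (xorSum q vs) ⊤ ⟩
  (xorSum q vs ≡ᵇ ⊤ ⊕ p)                          ≡⟨ cong (xorSum q vs ≡ᵇ_) (⊤-⊕ p) ⟩
  (xorSum q vs ≡ᵇ ∁ p)                            ∎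
  where open ≡-Reasoning

length-below : (τ : Bits n) → length (below τ) ≡ 2 ^ ∣ τ ∣
length-below []          = refl
length-below (false ∷ τ) = trans (length-map _ (below τ)) (length-below τ)
length-below (true  ∷ τ) = begin
  length (map (false ∷_) (below τ) List.++ map (true ∷_) (below τ))
    ≡⟨ length≡∑1 (map (false ∷_) (below τ) List.++ map (true ∷_) (below τ)) ⟩
  ∑[ _ ∈ map (false ∷_) (below τ) List.++ map (true ∷_) (below τ) ] 1
    ≡⟨ ∑-map++map (λ _ → 1) (false ∷_) (true ∷_) (below τ) ⟩
  (∑[ _ ∈ below τ ] 1) + (∑[ _ ∈ below τ ] 1)
    ≡⟨ cong (λ k → k + k) (trans (sym (length≡∑1 (below τ))) (length-below τ)) ⟩
  2 ^ ∣ τ ∣ + 2 ^ ∣ τ ∣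
    ≡⟨ cong (2 ^ ∣ τ ∣ +_) (sym (+-identityʳ _)) ⟩
  2 * 2 ^ ∣ τ ∣ ∎
  where open ≡-Reasoning

∑-products-∷ : {τ : Bits n} {τs : Vec (Bits n) m'} (f : Vec (Bits n) (suc m') → ℕ) →
  ∑ (products (τ ∷ τs)) f ≡ ∑[ v ∈ below τ ] ∑[ q ∈ products τs ] f (v ∷ q)
∑-products-∷ {τ = τ} {τs} f =
  trans (∑-concatMap f _ (below τ)) (∑-cong (below τ) (λ v → ∑-map f (v ∷_) (products τs)))

length-products-∷ : (τ : Bits n) (τs : Vec (Bits n) m') →
  length (products (τ ∷ τs)) ≡ length (below τ) * length (products τs)
length-products-∷ τ τs = begin
  length (products (τ ∷ τs))                    ≡⟨ length≡∑1 (products (τ ∷ τs)) ⟩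
  ∑[ _ ∈ products (τ ∷ τs) ] 1                  ≡⟨ ∑-products-∷ {τ = τ} {τs} (λ _ → 1) ⟩
  ∑[ _ ∈ below τ ] ∑[ _ ∈ products τs ] 1       ≡⟨ ∑-cong (below τ) (λ _ → sym (length≡∑1 (products τs))) ⟩
  ∑[ _ ∈ below τ ] length (products τs)         ≡⟨ ∑-const _ (below τ) ⟩
  length (below τ) * length (products τs)       ∎
  where open ≡-Reasoning

*-double : ∀ a b → a * b + a * b ≡ 2 * a * b
*-double = solve-∀

count-⊕⊆-below : (τ w U : Bits n) →
  count (λ v → w ⊕ v ⊆ᵇ U) (below τ) ≡ 2 ^ ∣ τ ∩ U ∣ * 𝟙[ w ⊆ᵇ τ ∪ U ]
count-⊕⊆-below []          []          []          = refl
count-⊕⊆-below (false ∷ τ) (false ∷ w) (y     ∷ U) =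
  trans (∑-map _ (false ∷_) (below τ)) (count-⊕⊆-below τ w U)
count-⊕⊆-below (false ∷ τ) (true  ∷ w) (false ∷ U) =
  trans (∑-map _ (false ∷_) (below τ)) (trans (∑-zero (below τ)) (sym (*-zeroʳ (2 ^ ∣ τ ∩ U ∣))))
count-⊕⊆-below (false ∷ τ) (true  ∷ w) (true  ∷ U) =
  trans (∑-map _ (false ∷_) (below τ)) (count-⊕⊆-below τ w U)
count-⊕⊆-below (true  ∷ τ) (false ∷ w) (false ∷ U) =
  trans (∑-map++map _ (false ∷_) (true ∷_) (below τ))
        (trans (cong₂ _+_ (count-⊕⊆-below τ w U) (∑-zero (below τ))) (+-identityʳ _))
count-⊕⊆-below (true  ∷ τ) (true  ∷ w) (false ∷ U) =
  trans (∑-map++map _ (false ∷_) (true ∷_) (below τ))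
        (cong₂ _+_ (∑-zero (below τ)) (count-⊕⊆-below τ w U))
count-⊕⊆-below (true  ∷ τ) (false ∷ w) (true  ∷ U) =
  trans (∑-map++map _ (false ∷_) (true ∷_) (below τ))
        (trans (cong₂ _+_ (count-⊕⊆-below τ w U) (count-⊕⊆-below τ w U)) (*-double (2 ^ ∣ τ ∩ U ∣) 𝟙[ w ⊆ᵇ τ ∪ U ]))
count-⊕⊆-below (true  ∷ τ) (true  ∷ w) (true  ∷ U) =
  trans (∑-map++map _ (false ∷_) (true ∷_) (below τ))
        (trans (cong₂ _+_ (count-⊕⊆-below τ w U) (count-⊕⊆-below τ w U)) (*-double (2 ^ ∣ τ ∩ U ∣) 𝟙[ w ⊆ᵇ τ ∪ U ]))

⋃-at : Subset m' → Vec (Bits n) m' → Subset n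
⋃-at []          []       = ⊥
⋃-at (false ∷ T) (τ ∷ τs) = ⋃-at T τs
⋃-at (true  ∷ T) (τ ∷ τs) = τ ∪ ⋃-at T τs

-- The sum of independent uniform vectors of the R^τ selected by T is uniform on R^(⋃-at T τs);
-- w ⊆ᵇ U says that w ∈ R^U.
count-xorSum≡ᵇ : (τs : Vec (Bits n) m') (T : Subset m') (w : Bits n) →
  count (λ p → xorSum T p ≡ᵇ w) (products τs) * 2 ^ ∣ ⋃-at T τs ∣
    ≡ length (products τs) * 𝟙[ w ⊆ᵇ ⋃-at T τs ]
count-xorSum≡ᵇ {n} [] [] w = begin
  (𝟙[ ⊥ ≡ᵇ w ] + 0) * 2 ^ ∣ ⊥ {n} ∣
    ≡⟨ cong₂ (λ b k → (𝟙[ b ] + 0) * 2 ^ k) (⊥-≡ᵇ w) (∣⊥∣≡0 n) ⟩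
  (𝟙[ w ⊆ᵇ ⊥ ] + 0) * 1
    ≡⟨ *-identityʳ _ ⟩
  1 * 𝟙[ w ⊆ᵇ ⊥ ] ∎
  where open ≡-Reasoning
count-xorSum≡ᵇ (τ ∷ τs) (false ∷ T) w = begin
  count (λ p → xorSum (false ∷ T) p ≡ᵇ w) (products (τ ∷ τs)) * u
    ≡⟨ cong (_* u) (trans (∑-products-∷ {τ = τ} {τs} _) (∑-const c (below τ))) ⟩
  length (below τ) * c * u        ≡⟨ *-assoc (length (below τ)) c u ⟩
  length (below τ) * (c * u)      ≡⟨ cong (length (below τ) *_) (count-xorSum≡ᵇ τs T w) ⟩
  length (below τ) * (P * I)      ≡⟨ sym (*-assoc (length (below τ)) P I) ⟩
  length (below τ) * P * I        ≡⟨ cong (_* I) (sym (length-products-∷ τ τs)) ⟩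
  length (products (τ ∷ τs)) * I  ∎
  where
  open ≡-Reasoning
  c u P I : ℕ
  c = count (λ q → xorSum T q ≡ᵇ w) (products τs)
  u = 2 ^ ∣ ⋃-at T τs ∣
  P = length (products τs)
  I = 𝟙[ w ⊆ᵇ ⋃-at T τs ]
count-xorSum≡ᵇ (τ ∷ τs) (true ∷ T) w = *-cancelˡ-≡ _ _ u {{m^n≢0 2 ∣ U ∣}} (begin
  u * (count (λ p → xorSum (true ∷ T) p ≡ᵇ w) (products (τ ∷ τs)) * 2 ^ ∣ τ ∪ U ∣)
    ≡⟨ cong (λ k → u * (k * 2 ^ ∣ τ ∪ U ∣)) count≡S ⟩
  u * (S * 2 ^ ∣ τ ∪ U ∣)                      ≡⟨ sym (*-assoc u S _) ⟩
  u * S * 2 ^ ∣ τ ∪ U ∣                        ≡⟨ cong (_* 2 ^ ∣ τ ∪ U ∣) u*S ⟩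
  P * (2 ^ ∣ τ ∩ U ∣ * I) * 2 ^ ∣ τ ∪ U ∣      ≡⟨ regroup P (2 ^ ∣ τ ∩ U ∣) I (2 ^ ∣ τ ∪ U ∣) ⟩
  P * I * (2 ^ ∣ τ ∩ U ∣ * 2 ^ ∣ τ ∪ U ∣)      ≡⟨ cong (P * I *_) (2^∣p∩q∣*2^∣p∪q∣ τ U) ⟩
  P * I * (2 ^ ∣ τ ∣ * u)                       ≡⟨ regroup′ P I (2 ^ ∣ τ ∣) u ⟩
  u * (2 ^ ∣ τ ∣ * P * I)                       ≡⟨ cong (λ k → u * (k * P * I)) (sym (length-below τ)) ⟩
  u * (length (below τ) * P * I)                ≡⟨ cong (λ k → u * (k * I)) (sym (length-products-∷ τ τs)) ⟩
  u * (length (products (τ ∷ τs)) * I)          ∎)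
  where
  open ≡-Reasoning
  U : Subset _
  U = ⋃-at T τs
  c : Bits _ → ℕ
  c x = count (λ q → xorSum T q ≡ᵇ x) (products τs)
  u P I S : ℕ
  u = 2 ^ ∣ U ∣
  P = length (products τs)
  I = 𝟙[ w ⊆ᵇ τ ∪ U ]
  S = ∑[ v ∈ below τ ] c (w ⊕ v)
  count≡S : count (λ p → xorSum (true ∷ T) p ≡ᵇ w) (products (τ ∷ τs)) ≡ S
  count≡S = trans (∑-products-∷ {τ = τ} {τs} _) (∑-cong (below τ) λ v →
    ∑-cong (products τs) λ q → cong 𝟙[_] (⊕-≡ᵇ v (xorSum T q) w))
  u*S : u * S ≡ P * (2 ^ ∣ τ ∩ U ∣ * I)
  u*S = begin
    u * S                                        ≡⟨ sym (∑-*ˡ u (c ∘ (w ⊕_)) (below τ)) ⟩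
    ∑[ v ∈ below τ ] u * c (w ⊕ v)               ≡⟨ ∑-cong (below τ) (λ v → trans (*-comm u _) (count-xorSum≡ᵇ τs T (w ⊕ v))) ⟩
    ∑[ v ∈ below τ ] P * 𝟙[ w ⊕ v ⊆ᵇ U ]        ≡⟨ ∑-*ˡ P _ (below τ) ⟩
    P * count (λ v → w ⊕ v ⊆ᵇ U) (below τ)       ≡⟨ cong (P *_) (count-⊕⊆-below τ w U) ⟩
    P * (2 ^ ∣ τ ∩ U ∣ * I)                       ∎
  regroup : ∀ p a i b → p * (a * i) * b ≡ p * i * (a * b)
  regroup = solve-∀
  regroup′ : ∀ p i a u → p * i * (a * u) ≡ u * (a * p * i)
  regroup′ = solve-∀

≡*𝟙⇒*2^≤ : {c P : ℕ} (k₁ k₂ : ℕ) (b : Bool) →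
  c * 2 ^ k₂ ≡ P * 𝟙[ b ] → (T b → k₁ ≤ k₂) → c * 2 ^ k₁ ≤ P
≡*𝟙⇒*2^≤ {c} {P} k₁ k₂ true  eq k₁≤k₂ = begin
  c * 2 ^ k₁  ≤⟨ *-monoʳ-≤ c (^-monoʳ-≤ 2 (k₁≤k₂ _)) ⟩
  c * 2 ^ k₂  ≡⟨ eq ⟩
  P * 1       ≡⟨ *-identityʳ P ⟩
  P           ∎
  where open ≤-Reasoning
≡*𝟙⇒*2^≤ {c} {P} k₁ k₂ false eq _
  rewrite m*n≡0⇒m≡0 c (2 ^ k₂) {{m^n≢0 2 k₂}} (trans eq (*-zeroʳ P)) = z≤n

count-isOnes-xorSum : (τs : Vec (Bits n) m') (T : Subset (n + m')) →
  count (λ r → isOnes (xorSum T r)) (goodBase τs) * 2 ^ n ≤ length (goodBase τs) * 2 ^ ∣ T ∣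
count-isOnes-xorSum {n} τs T with splitAt n T
... | T₁ , T₂ , refl = begin
  count (λ r → isOnes (xorSum (T₁ ++ T₂) r)) (goodBase τs) * 2 ^ n
    ≡⟨ cong₂ _*_ count≡c (cong (2 ^_) (sym (∣∁p∣+∣p∣ T₁))) ⟩
  c * 2 ^ (∣ ∁ T₁ ∣ + ∣ T₁ ∣)
    ≡⟨ trans (cong (c *_) (^-distribˡ-+-* 2 ∣ ∁ T₁ ∣ ∣ T₁ ∣)) (sym (*-assoc c _ _)) ⟩
  c * 2 ^ ∣ ∁ T₁ ∣ * 2 ^ ∣ T₁ ∣
    ≤⟨ *-monoˡ-≤ (2 ^ ∣ T₁ ∣) (≡*𝟙⇒*2^≤ {c} {length (products τs)} ∣ ∁ T₁ ∣ ∣ U ∣ (∁ T₁ ⊆ᵇ U)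
         (count-xorSum≡ᵇ τs T₂ (∁ T₁)) (⊆ᵇ⇒∣∣≤ (∁ T₁) U)) ⟩
  length (products τs) * 2 ^ ∣ T₁ ∣
    ≤⟨ *-mono-≤ (≤-reflexive (sym (length-map (units n ++_) (products τs))))
                (^-monoʳ-≤ 2 (∣p∣≤∣p++q∣ T₁ T₂)) ⟩
  length (goodBase τs) * 2 ^ ∣ T₁ ++ T₂ ∣ ∎
  where
  open ≤-Reasoning
  U : Subset n
  U = ⋃-at T₂ τs
  c : ℕ
  c = count (λ p → xorSum T₂ p ≡ᵇ ∁ T₁) (products τs)
  count≡c : count (λ r → isOnes (xorSum (T₁ ++ T₂) r)) (goodBase τs) ≡ c
  count≡c = trans (∑-map _ (units n ++_) (products τs))
    (∑-cong (products τs) (λ p → cong 𝟙[_] (isOnes-xorSum-units++ T₁ T₂ p)))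

-- The union bound and the weight of the small subsets

1≤𝟙[allB]+∑ : (a b : B → Bool) (S : List B) →
  1 ≤ 𝟙[ allB (λ t → not (a t) ∨ not (b t)) S ] + (∑[ t ∈ S ] 𝟙[ a t ] * 𝟙[ b t ])
1≤𝟙[allB]+∑ a b []      = s≤s z≤n
1≤𝟙[allB]+∑ a b (t ∷ S) with a t | b t
... | true  | true  = s≤s z≤n
... | true  | false = 1≤𝟙[allB]+∑ a b S
... | false | _     = 1≤𝟙[allB]+∑ a b S

union-bound : (a : B → Bool) (b : B → A → Bool) (S : List B) (G : List A) →
  length G ≤ count (λ r → allB (λ t → not (a t) ∨ not (b t r)) S) G
             + (∑[ t ∈ S ] 𝟙[ a t ] * count (b t) G)
union-bound {A = A} a b S G = begin
  length G
    ≡⟨ length≡∑1 G ⟩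
  ∑[ _ ∈ G ] 1
    ≤⟨ ∑-mono-≤ G (λ r → 1≤𝟙[allB]+∑ a (λ t → b t r) S) ⟩
  ∑[ r ∈ G ] (𝟙[ good r ] + (∑[ t ∈ S ] 𝟙[ a t ] * 𝟙[ b t r ]))
    ≡⟨ ∑-+ (λ r → 𝟙[ good r ]) _ G ⟩
  count good G + (∑[ r ∈ G ] ∑[ t ∈ S ] 𝟙[ a t ] * 𝟙[ b t r ])
    ≡⟨ cong (count good G +_) (∑-comm (λ r t → 𝟙[ a t ] * 𝟙[ b t r ]) G S) ⟩
  count good G + (∑[ t ∈ S ] ∑[ r ∈ G ] 𝟙[ a t ] * 𝟙[ b t r ])
    ≡⟨ cong (count good G +_) (∑-cong S (λ t → ∑-*ˡ 𝟙[ a t ] (λ r → 𝟙[ b t r ]) G)) ⟩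
  count good G + (∑[ t ∈ S ] 𝟙[ a t ] * count (b t) G) ∎
  where
  open ≤-Reasoning
  good : A → Bool
  good r = allB (λ t → not (a t) ∨ not (b t r)) S

𝟙[≤ᵇ]*≤ : (x N : ℕ) → 𝟙[ x ≤ᵇ N ] * x ≤ N
𝟙[≤ᵇ]*≤ x N with x ≤ᵇ N in x≤ᵇN
... | true  = ≤-trans (≤-reflexive (+-identityʳ x)) (≤ᵇ⇒≤ x N (subst T (sym x≤ᵇN) tt))
... | false = z≤n

-- Splitting off one element, the sets containing it meet the threshold M * a instead of M and
-- weigh twice as much; the factor 1 + 2/a this costs is below (k+2)/(k+1) as 2(k+1) ≤ a.
∑-allSubsets-≤ᵇ : (a k : ℕ) → 2 * k ≤ a → (M N : ℕ) →
  (∑[ T ∈ allSubsets k ] 𝟙[ M * a ^ ∣ T ∣ ≤ᵇ N ] * 2 ^ ∣ T ∣) * M ≤ N * suc k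
∑-allSubsets-≤ᵇ a zero _ M N = begin
  (𝟙[ M * 1 ≤ᵇ N ] * 1 + 0) * M  ≡⟨ regroup 𝟙[ M * 1 ≤ᵇ N ] M ⟩
  𝟙[ M * 1 ≤ᵇ N ] * (M * 1)      ≤⟨ 𝟙[≤ᵇ]*≤ (M * 1) N ⟩
  N                               ≡⟨ sym (*-identityʳ N) ⟩
  N * 1                           ∎
  where
  open ≤-Reasoning
  regroup : ∀ i M → (i * 1 + 0) * M ≡ i * (M * 1)
  regroup = solve-∀
∑-allSubsets-≤ᵇ a (suc k) 2k+2≤a M N = *-cancelˡ-≤ a {{a≢0}} (begin
  a * ((∑[ T ∈ allSubsets (suc k) ] 𝟙[ M * a ^ ∣ T ∣ ≤ᵇ N ] * 2 ^ ∣ T ∣) * M)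
    ≡⟨ cong (λ s → a * (s * M)) (∑-map++map _ (false ∷_) (true ∷_) (allSubsets k)) ⟩
  a * ((F M + (∑[ T ∈ allSubsets k ] 𝟙[ M * (a * a ^ ∣ T ∣) ≤ᵇ N ] * (2 * 2 ^ ∣ T ∣))) * M)
    ≡⟨ cong (λ s → a * ((F M + s) * M)) (trans (∑-cong (allSubsets k) shift) (∑-*ˡ 2 _ (allSubsets k))) ⟩
  a * ((F M + 2 * F (M * a)) * M)
    ≡⟨ expand a (F M) (F (M * a)) M ⟩
  a * (F M * M) + 2 * (F (M * a) * (M * a))
    ≤⟨ +-mono-≤ (*-monoʳ-≤ a (∑-allSubsets-≤ᵇ a k 2k≤a M N)) (*-monoʳ-≤ 2 (∑-allSubsets-≤ᵇ a k 2k≤a (M * a) N)) ⟩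
  a * (N * suc k) + 2 * (N * suc k)
    ≡⟨ expand′ a N k ⟩
  N * (a * suc k) + N * (2 * suc k)
    ≤⟨ +-monoʳ-≤ (N * (a * suc k)) (*-monoʳ-≤ N 2k+2≤a) ⟩
  N * (a * suc k) + N * a
    ≡⟨ collect a N k ⟩
  a * (N * suc (suc k)) ∎)
  where
  open ≤-Reasoning
  F : ℕ → ℕ
  F M = ∑[ T ∈ allSubsets k ] 𝟙[ M * a ^ ∣ T ∣ ≤ᵇ N ] * 2 ^ ∣ T ∣
  a≢0 : NonZero a
  a≢0 = >-nonZero (≤-trans (s≤s z≤n) 2k+2≤a)
  2k≤a : 2 * k ≤ a
  2k≤a = ≤-trans (*-monoʳ-≤ 2 (n≤1+n k)) 2k+2≤a
  shift : (T : Subset k) →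
    𝟙[ M * (a * a ^ ∣ T ∣) ≤ᵇ N ] * (2 * 2 ^ ∣ T ∣) ≡ 2 * (𝟙[ M * a * a ^ ∣ T ∣ ≤ᵇ N ] * 2 ^ ∣ T ∣)
  shift T = trans (cong (λ x → 𝟙[ x ≤ᵇ N ] * (2 * 2 ^ ∣ T ∣)) (sym (*-assoc M a (a ^ ∣ T ∣))))
                  (swap 𝟙[ M * a * a ^ ∣ T ∣ ≤ᵇ N ] (2 ^ ∣ T ∣))
    where
    swap : ∀ i x → i * (2 * x) ≡ 2 * (i * x)
    swap = solve-∀
  expand : ∀ a f g M → a * ((f + 2 * g) * M) ≡ a * (f * M) + 2 * (g * (M * a))
  expand = solve-∀
  expand′ : ∀ a N k → a * (N * suc k) + 2 * (N * suc k) ≡ N * (a * suc k) + N * (2 * suc k)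
  expand′ = solve-∀
  collect : ∀ a N k → N * (a * suc k) + N * a ≡ a * (N * suc (suc k))
  collect = solve-∀

8*m≤m^4 : {m : ℕ} → 2 ≤ m → 8 * m ≤ m ^ 4
8*m≤m^4 {m} 2≤m = ≤-trans (≤-reflexive (*-comm 8 m)) (*-monoʳ-≤ m (^-monoˡ-≤ 3 2≤m))

3*[1+m]≤8*m : {m : ℕ} → 2 ≤ m → 3 * suc m ≤ 8 * m
3*[1+m]≤8*m {m} 2≤m = begin
  3 * suc m      ≡⟨ *-suc 3 m ⟩
  3 + 3 * m      ≤⟨ +-monoˡ-≤ (3 * m) (≤-trans (s≤s (s≤s (s≤s z≤n))) (*-monoʳ-≤ 5 2≤m)) ⟩
  5 * m + 3 * m  ≡⟨ sym (*-distribʳ-+ m 5 3) ⟩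
  8 * m          ∎
  where open ≤-Reasoning

small-subsets-weight : (m n : ℕ) → 2 ≤ m →
  3 * (∑[ T ∈ allSubsets m ] 𝟙[ smallEnough n T ] * 2 ^ ∣ T ∣) ≤ 2 ^ n
small-subsets-weight m n 2≤m = *-cancelʳ-≤ (3 * W) (2 ^ n) (suc m) (begin
  3 * W * suc m    ≡⟨ trans (cong (_* suc m) (*-comm 3 W)) (*-assoc W 3 (suc m)) ⟩
  W * (3 * suc m)  ≤⟨ *-monoʳ-≤ W (≤-trans (3*[1+m]≤8*m 2≤m) (8*m≤m^4 2≤m)) ⟩
  W * m ^ 4        ≡⟨ cong (_* m ^ 4) W≡ ⟩
  (∑[ T ∈ allSubsets m ] 𝟙[ m ^ 4 * (m ^ 4) ^ ∣ T ∣ ≤ᵇ 2 ^ n ] * 2 ^ ∣ T ∣) * m ^ 4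
                   ≤⟨ ∑-allSubsets-≤ᵇ (m ^ 4) m 2m≤m^4 (m ^ 4) (2 ^ n) ⟩
  2 ^ n * suc m    ∎)
  where
  open ≤-Reasoning
  W : ℕ
  W = ∑[ T ∈ allSubsets m ] 𝟙[ smallEnough n T ] * 2 ^ ∣ T ∣
  W≡ : W ≡ ∑[ T ∈ allSubsets m ] 𝟙[ m ^ 4 * (m ^ 4) ^ ∣ T ∣ ≤ᵇ 2 ^ n ] * 2 ^ ∣ T ∣
  W≡ = ∑-cong (allSubsets m)
    (λ T → cong (λ x → 𝟙[ x ≤ᵇ 2 ^ n ] * 2 ^ ∣ T ∣) (sym (^-*-assoc m 4 (suc ∣ T ∣))))
  2m≤m^4 : 2 * m ≤ m ^ 4
  2m≤m^4 = ≤-trans (*-monoˡ-≤ m {2} {8} (s≤s (s≤s z≤n))) (8*m≤m^4 2≤m)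

*-scale-≤ : {a b L N : ℕ} (i : ℕ) → a * N ≤ L * b → i * a * N ≤ L * (i * b)
*-scale-≤ {a} {b} {L} {N} i aN≤Lb = begin
  i * a * N    ≡⟨ *-assoc i a N ⟩
  i * (a * N)  ≤⟨ *-monoʳ-≤ i aN≤Lb ⟩
  i * (L * b)  ≡⟨ x*[y*z]≡y*[x*z] i L b ⟩
  L * (i * b)  ∎
  where open ≤-Reasoning

third-bound : {B L W N : ℕ} .{{_ : NonZero N}} → B * N ≤ L * W → 3 * W ≤ N → 3 * B ≤ L
third-bound {B} {L} {W} {N} BN≤LW 3W≤N = *-cancelʳ-≤ (3 * B) L N (begin
  3 * B * N    ≡⟨ *-assoc 3 B N ⟩
  3 * (B * N)  ≤⟨ *-monoʳ-≤ 3 BN≤LW ⟩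
  3 * (L * W)  ≡⟨ x*[y*z]≡y*[x*z] 3 L W ⟩
  L * (3 * W)  ≤⟨ *-monoʳ-≤ L 3W≤N ⟩
  L * N        ∎)
  where open ≤-Reasoning

two-thirds : {L E B : ℕ} → L ≤ E + B → 3 * B ≤ L → 2 * L ≤ 3 * E
two-thirds {L} {E} {B} L≤E+B 3B≤L = +-cancelˡ-≤ L (2 * L) (3 * E) (begin
  L + 2 * L       ≡⟨⟩
  3 * L           ≤⟨ *-monoʳ-≤ 3 L≤E+B ⟩
  3 * (E + B)     ≡⟨ *-distribˡ-+ 3 E B ⟩
  3 * E + 3 * B   ≤⟨ +-monoʳ-≤ (3 * E) 3B≤L ⟩
  3 * E + L       ≡⟨ +-comm (3 * E) L ⟩
  L + 3 * E       ∎)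
  where open ≤-Reasoning

claim3p3 : (n m' : ℕ) (τs : Vec (Bits n) m') → 2 ≤ n + m' →
    2 * length (goodBase τs) ≤ 3 * countEvent τs
claim3p3 n m' τs 2≤m =
  subst (λ e → 2 * length G ≤ 3 * e) (sym (length-filter≡count event G))
    (two-thirds {E = count event G} {B = bad-weight} (union-bound small bad (allSubsets m) G)
                (third-bound {B = bad-weight} {{m^n≢0 2 n}} bad-weight-bound (small-subsets-weight m n 2≤m)))
  where
  m : ℕ
  m = n + m'
  G : List (Vec (Bits n) m)
  G = goodBase τs
  small : Subset m → Bool
  small = smallEnough n
  bad : Subset m → Vec (Bits n) m → Bool
  bad T r = isOnes (xorSum T r)
  bad-weight : ℕ
  bad-weight = ∑[ T ∈ allSubsets m ] 𝟙[ small T ] * count (bad T) G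
  bad-weight-bound : bad-weight * 2 ^ n ≤ length G * (∑[ T ∈ allSubsets m ] 𝟙[ small T ] * 2 ^ ∣ T ∣)
  bad-weight-bound = ∑-*-≤ {L = length G} (allSubsets m)
    (λ T → *-scale-≤ {L = length G} 𝟙[ small T ] (count-isOnes-xorSum τs T))
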